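{- (Type checking implies type inference.) Let $g:\mathbb N\to\mathbb N$ satisfy $h<g(h)$ for all $h$. For every environment $C$ and terms $T,V$: if $C\vdash_g T:V$, then there exists a term $U$ such that $C\vdash_g\mathrm{cast}(V,T):U$.
   Context: Terms of $\lambda\delta$: $T ::= \ast h \mid x \mid \lambda x{:}W.\,T \mid \delta x{=}V.\,T \mid \mathrm{appl}(V,T) \mid \mathrm{cast}(W,T)$ ($h\in\mathbb N$, $x$ a variable); $\ast h$ is a sort, $\lambda x{:}W.T$ abstraction over type $W$, $\delta x{=}V.T$ the abbreviation "let $x=V$ in $T$", $\mathrm{appl}(V,T)$ application of $T$ to argument $V$, $\mathrm{cast}(W,T)$ $T$ annotated with type $W$. In $\lambda x{:}W.T$, $\delta x{=}V.T$, $x$ is bound in $T$ only; $\mathrm{FV}(T)$ free variables; terms up to renaming of bound variables with bound and free names disjoint. Environments: $E ::= \ast h \mid \lambda x{:}W.E \mid \delta x{=}V.E \mid \mathrm{appl}(V,E)\mid\mathrm{cast}(W,E)$. $E.\lambda x{:}W$ (resp. $E.\delta x{=}V$) is $E$ with its terminal sort $\ast h$ replaced by $\lambda x{:}W.\ast h$ (resp. $\delta x{=}V.\ast h$). $E=C_1\cdot\beta\cdot C_2$, for an item $\beta$ of the form $\lambda x{:}W$ or $\delta x{=}V$, means $E$ is obtained from the environment $C_1$ by replacing its terminal sort with $\beta.C_2$ for some environment $C_2$. Strict substitution: $T[x:=^+W]\,T'$ iff $x\notin\mathrm{FV}(W)$, $x\in\mathrm{FV}(T)$ and $T'$ arises from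 $T$ by replacing a nonempty set of free occurrences of $x$ by $W$. Environment-free parallel reduction $\to_0$: least relation closed under (refl) $T\to_0T$; (compatibility) if $A_1\to_0A_2$, $T_1\to_0T_2$ then $\lambda x{:}A_1.T_1\to_0\lambda x{:}A_2.T_2$, $\delta x{=}A_1.T_1\to_0\delta x{=}A_2.T_2$, $\mathrm{appl}(A_1,T_1)\to_0\mathrm{appl}(A_2,T_2)$, $\mathrm{cast}(A_1,T_1)\to_0\mathrm{cast}(A_2,T_2)$; ($\beta$) if $V_1\to_0V_2$, $T_1\to_0T_2$ then $\mathrm{appl}(V_1,\lambda x{:}W.T_1)\to_0\delta x{=}V_2.T_2$; ($\delta$) if $V_1\to_0V_2$, $T_1\to_0T_2$, $T_2[x:=^+V_2]T$ then $\delta x{=}V_1.T_1\to_0\delta x{=}V_2.T$; ($\zeta$) if $T_1\to_0T_2$, $x\notin\mathrm{FV}(T_1)$ then $\delta x{=}V.T_1\to_0T_2$; ($\tau$) if $T_1\to_0T_2$ then $\mathrm{cast}(W,T_1)\to_0T_2$; ($\upsilon$) if $V_1\to_0V_3$, $V_2\to_0V_4$, $T_1\to_0T_2$ then $\mathrm{appl}(V_1,\delta x{=}V_2.T_1)\to_0\delta x{=}V_4.\mathrm{appl}(V_3,T_2)$. $E\vdash T_1\to T_2$ iff $T_1\to_0T_2$, or $E=C_1\cdot\delta x{=}V\cdot C_2$, $T_1\to_0T'$, $T'[x:=^+V]T_2$. Conversion $E\vdash T_1\Leftrightarrow T_2$ is its symmetric and transitive closure. Native type assignment $E\vdash_g T:U$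 is the least relation closed under: (sort) $E\vdash_g\ast h:\ast g(h)$; (def) if $E=C_1\cdot\delta x{=}V\cdot C_2$ and $C_1\vdash_g V:W$ then $E\vdash_g x:W$; (decl) if $E=C_1\cdot\lambda x{:}W\cdot C_2$ and $C_1\vdash_g W:V$ then $E\vdash_g x:W$; (abbr) if $E\vdash_g V:W$ and $E.\delta x{=}V\vdash_g T:U$ then $E\vdash_g\delta x{=}V.T:\delta x{=}V.U$; (abst) if $E\vdash_g W:V$ and $E.\lambda x{:}W\vdash_g T:U$ then $E\vdash_g\lambda x{:}W.T:\lambda x{:}W.U$; (appl) if $E\vdash_g V:W$ and $E\vdash_g T:\lambda x{:}W.U$ then $E\vdash_g\mathrm{appl}(V,T):\mathrm{appl}(V,\lambda x{:}W.U)$; (cast) if $E\vdash_g T:W$ and $E\vdash_g W:V$ then $E\vdash_g\mathrm{cast}(W,T):\mathrm{cast}(V,W)$; (conv) if $E\vdash_g U_2:W$, $E\vdash_g T:U_1$ and $E\vdash U_1\Leftrightarrow U_2$ then $E\vdash_g T:U_2$. -}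

module Defs where

open import Data.Nat using (ℕ; zero; suc; _+_; _<ᵇ_)
open import Data.Bool using (Bool; true; false; _∨_; if_then_else_)
open import Data.Product using (_×_)
open import Relation.Nullary using (¬_)
open import Relation.Binary.PropositionalEquality using (_≡_)

-- Terms of λδ, with variables as de Bruijn indices (terms up to α-renaming).
-- lam W T : λx:W.T ; abbr V T : δx=V.T  (T is under one binder)
-- appl V T : appl(V,T) ; cast W T : cast(W,T)
data Term : Set where
  sort : ℕ → Term
  var  : ℕ → Term
  lam  : Term → Term → Term
  abbr : Term → Term → Term
  appl : Term → Term → Term
  cast : Term → Term → Term

lift : ℕ → ℕ → Term → Term
lift d c (sort h)   = sort h
lift d c (var j)    = if j <ᵇ c then var j else var (j + d)
lift d c (lam A T)  = lam (lift d c A) (lift d (suc c) T)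
lift d c (abbr A T) = abbr (lift d c A) (lift d (suc c) T)
lift d c (appl A T) = appl (lift d c A) (lift d c T)
lift d c (cast A T) = cast (lift d c A) (lift d c T)

data Free : ℕ → Term → Set where
  fvar   : ∀ {i} → Free i (var i)
  flamA  : ∀ {i A T} → Free i A → Free i (lam A T)
  flamT  : ∀ {i A T} → Free (suc i) T → Free i (lam A T)
  fabbrA : ∀ {i A T} → Free i A → Free i (abbr A T)
  fabbrT : ∀ {i A T} → Free (suc i) T → Free i (abbr A T)
  fapplA : ∀ {i A T} → Free i A → Free i (appl A T)
  fapplT : ∀ {i A T} → Free i T → Free i (appl A T)
  fcastA : ∀ {i A T} → Free i A → Free i (cast A T)
  fcastT : ∀ {i A T} → Free i T → Free i (cast A T)

-- Rep i W b T T' : T' arises from T by replacing some set of free occurrences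
-- of variable i by W; b = true iff that set is nonempty.
data Rep : ℕ → Term → Bool → Term → Term → Set where
  rsort : ∀ {i W h} → Rep i W false (sort h) (sort h)
  rkeep : ∀ {i W j} → Rep i W false (var j) (var j)
  rrepl : ∀ {i W} → Rep i W true (var i) W
  rlam  : ∀ {i W b₁ b₂ A A' T T'} → Rep i W b₁ A A' → Rep (suc i) (lift 1 0 W) b₂ T T' →
          Rep i W (b₁ ∨ b₂) (lam A T) (lam A' T')
  rabbr : ∀ {i W b₁ b₂ A A' T T'} → Rep i W b₁ A A' → Rep (suc i) (lift 1 0 W) b₂ T T' →
          Rep i W (b₁ ∨ b₂) (abbr A T) (abbr A' T')
  rappl : ∀ {i W b₁ b₂ A A' T T'} → Rep i W b₁ A A' → Rep i W b₂ T T' →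
          Rep i W (b₁ ∨ b₂) (appl A T) (appl A' T')
  rcast : ∀ {i W b₁ b₂ A A' T T'} → Rep i W b₁ A A' → Rep i W b₂ T T' →
          Rep i W (b₁ ∨ b₂) (cast A T) (cast A' T')

StrictSubst : ℕ → Term → Term → Term → Set
StrictSubst x T W T' = ¬ Free x W × Free x T × Rep x W true T T'

data _→0_ : Term → Term → Set where
  refl0 : ∀ {T} → T →0 T
  clam  : ∀ {A₁ A₂ T₁ T₂} → A₁ →0 A₂ → T₁ →0 T₂ → lam A₁ T₁ →0 lam A₂ T₂
  cabbr : ∀ {A₁ A₂ T₁ T₂} → A₁ →0 A₂ → T₁ →0 T₂ → abbr A₁ T₁ →0 abbr A₂ T₂
  cappl : ∀ {A₁ A₂ T₁ T₂} → A₁ →0 A₂ → T₁ →0 T₂ → appl A₁ T₁ →0 appl A₂ T₂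
  ccast : ∀ {A₁ A₂ T₁ T₂} → A₁ →0 A₂ → T₁ →0 T₂ → cast A₁ T₁ →0 cast A₂ T₂
  β0    : ∀ {V₁ V₂ W T₁ T₂} → V₁ →0 V₂ → T₁ →0 T₂ → appl V₁ (lam W T₁) →0 abbr V₂ T₂
  δ0    : ∀ {V₁ V₂ T₁ T₂ T} → V₁ →0 V₂ → T₁ →0 T₂ →
          StrictSubst 0 T₂ (lift 1 0 V₂) T → abbr V₁ T₁ →0 abbr V₂ T
  -- x ∉ FV(T₁); T₂ is the result with the (unused) binder removed
  ζ0    : ∀ {V T₁ T₂} → T₁ →0 lift 1 0 T₂ → ¬ Free 0 T₁ → abbr V T₁ →0 T₂
  τ0    : ∀ {W T₁ T₂} → T₁ →0 T₂ → cast W T₁ →0 T₂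
  υ0    : ∀ {V₁ V₂ V₃ V₄ T₁ T₂} → V₁ →0 V₃ → V₂ →0 V₄ → T₁ →0 T₂ →
          appl V₁ (abbr V₂ T₁) →0 abbr V₄ (appl (lift 1 0 V₃) T₂)

data Env : Set where
  sortE : ℕ → Env
  lamE  : Term → Env → Env
  abbrE : Term → Env → Env
  applE : Term → Env → Env
  castE : Term → Env → Env

data Item : Set where
  iλ : Term → Item
  iδ : Term → Item

itemE : Item → Env → Env
itemE (iλ W) E = lamE W E
itemE (iδ V) E = abbrE V E

plug : Env → Item → Env → Env
plug (sortE h)   β C₂ = itemE β C₂
plug (lamE W C)  β C₂ = lamE W (plug C β C₂)
plug (abbrE V C) β C₂ = abbrE V (plug C β C₂)
plug (applE V C) β C₂ = applE V (plug C β C₂)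
plug (castE W C) β C₂ = castE W (plug C β C₂)

terminal : Env → ℕ
terminal (sortE h)   = h
terminal (lamE _ C)  = terminal C
terminal (abbrE _ C) = terminal C
terminal (applE _ C) = terminal C
terminal (castE _ C) = terminal C

_∙_ : Env → Item → Env
E ∙ β = plug E β (sortE (terminal E))

-- number of binding items of an environment (the de Bruijn index of the
-- item β in C₁ · β · C₂ is nb C₂)
nb : Env → ℕ
nb (sortE _)   = 0
nb (lamE _ C)  = suc (nb C)
nb (abbrE _ C) = suc (nb C)
nb (applE _ C) = nb C
nb (castE _ C) = nb C

data _⊢_⇒_ : Env → Term → Term → Set where
  red0 : ∀ {E T₁ T₂} → T₁ →0 T₂ → E ⊢ T₁ ⇒ T₂
  redδ : ∀ {C₁ V C₂ T₁ T' T₂} → T₁ →0 T' →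
         StrictSubst (nb C₂) T' (lift (suc (nb C₂)) 0 V) T₂ →
         plug C₁ (iδ V) C₂ ⊢ T₁ ⇒ T₂

data _⊢_⇔_ : Env → Term → Term → Set where
  cstep  : ∀ {E T₁ T₂} → E ⊢ T₁ ⇒ T₂ → E ⊢ T₁ ⇔ T₂
  csym   : ∀ {E T₁ T₂} → E ⊢ T₁ ⇔ T₂ → E ⊢ T₂ ⇔ T₁
  ctrans : ∀ {E T₁ T₂ T₃} → E ⊢ T₁ ⇔ T₂ → E ⊢ T₂ ⇔ T₃ → E ⊢ T₁ ⇔ T₃

data _⊢[_]_∶_ : Env → (ℕ → ℕ) → Term → Term → Set where
  tsort : ∀ {E g h} → E ⊢[ g ] sort h ∶ sort (g h)
  tdef  : ∀ {g C₁ V C₂ W} → C₁ ⊢[ g ] V ∶ W →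
          plug C₁ (iδ V) C₂ ⊢[ g ] var (nb C₂) ∶ lift (suc (nb C₂)) 0 W
  tdecl : ∀ {g C₁ W C₂ V} → C₁ ⊢[ g ] W ∶ V →
          plug C₁ (iλ W) C₂ ⊢[ g ] var (nb C₂) ∶ lift (suc (nb C₂)) 0 W
  tabbr : ∀ {E g V W T U} → E ⊢[ g ] V ∶ W → (E ∙ iδ V) ⊢[ g ] T ∶ U →
          E ⊢[ g ] abbr V T ∶ abbr V U
  tabst : ∀ {E g W V T U} → E ⊢[ g ] W ∶ V → (E ∙ iλ W) ⊢[ g ] T ∶ U →
          E ⊢[ g ] lam W T ∶ lam W U
  tappl : ∀ {E g V W T U} → E ⊢[ g ] V ∶ W → E ⊢[ g ] T ∶ lam W U →
          E ⊢[ g ] appl V T ∶ appl V (lam W U)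
  tcast : ∀ {E g T W V} → E ⊢[ g ] T ∶ W → E ⊢[ g ] W ∶ V →
          E ⊢[ g ] cast W T ∶ cast V W
  tconv : ∀ {E g T U₁ U₂ W} → E ⊢[ g ] U₂ ∶ W → E ⊢[ g ] T ∶ U₁ → E ⊢ U₁ ⇔ U₂ →
          E ⊢[ g ] T ∶ U₂

{-# OPTIONS --safe #-}
module Submission where

-- A cast cast(V,T) is typable as soon as its annotation V is, so the theorem
-- reduces to validity: every type of a typable term is itself typable. The
-- only cases of validity that are not immediate are the variables, whose
-- type is the type of an environment entry relocated into a longer
-- environment; these follow from weakening (thinning), proved by induction
-- on the typing derivation for the insertion of an arbitrary environment
-- at an arbitrary depth.

open import Defs
open import Data.Nat using (ℕ; suc; _+_; _<_; _≤_; _<ᵇ_; _<?_; s≤s)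
open import Data.Nat.Properties
  using (<⇒<ᵇ; <ᵇ⇒<; ≤⇒≯; <⇒≱; ≮⇒≥; ≤-trans; <-≤-trans; m≤m+n; m≤n⇒m≤1+n; +-mono-≤; +-monoˡ-≤; +-monoˡ-<;
         +-assoc; +-comm; +-suc; +-identityʳ; ≤-reflexive; +-cancelʳ-≡; +-commutativeSemigroup)
open import Algebra.Properties.CommutativeSemigroup +-commutativeSemigroup using (xy∙z≈xz∙y)
open import Data.Bool using (true; false; if_then_else_)
open import Data.Unit using (tt)
open import Data.Product using (∃; _×_; _,_; proj₂)
open import Relation.Nullary using (¬_; yes; no; contradiction)
open import Relation.Binary.PropositionalEquality
  using (_≡_; _≢_; refl; sym; trans; cong; cong₂; subst; subst₂; module ≡-Reasoning)

liftIndex : ℕ → ℕ → ℕ → ℕ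
liftIndex d c j = if j <ᵇ c then j else j + d

lift-var : ∀ d c j → lift d c (var j) ≡ var (liftIndex d c j)
lift-var d c j with j <ᵇ c
... | true  = refl
... | false = refl

liftIndex-< : ∀ {d c j} → j < c → liftIndex d c j ≡ j
liftIndex-< {c = c} {j} j<c with j <ᵇ c | <⇒<ᵇ j<c
... | true | _ = refl

liftIndex-≥ : ∀ {d c j} → c ≤ j → liftIndex d c j ≡ j + d
liftIndex-≥ {c = c} {j} c≤j with j <ᵇ c | <ᵇ⇒< j c
... | false | _   = refl
... | true  | j<c = contradiction (j<c tt) (≤⇒≯ c≤j)

liftIndex-suc : ∀ d c j → liftIndex d (suc c) (suc j) ≡ suc (liftIndex d c j)
liftIndex-suc d c j with j <ᵇ c
... | true  = refl
... | false = refl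

liftIndex-separates : ∀ {d c i j} → i < c → c ≤ j → liftIndex d c i ≢ liftIndex d c j
liftIndex-separates {d} {c} {i} {j} i<c c≤j eq = <⇒≱ i<c (subst (c ≤_) j+d≡i (≤-trans c≤j (m≤m+n j d)))
  where j+d≡i = trans (sym (liftIndex-≥ c≤j)) (trans (sym eq) (liftIndex-< i<c))

liftIndex-injective : ∀ d c {i j} → liftIndex d c i ≡ liftIndex d c j → i ≡ j
liftIndex-injective d c {i} {j} eq with i <? c | j <? c
... | yes i<c | yes j<c = trans (sym (liftIndex-< i<c)) (trans eq (liftIndex-< j<c))
... | no i≮c  | no j≮c  =
  +-cancelʳ-≡ d i j (trans (sym (liftIndex-≥ (≮⇒≥ i≮c))) (trans eq (liftIndex-≥ (≮⇒≥ j≮c))))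
... | yes i<c | no j≮c  = contradiction eq (liftIndex-separates i<c (≮⇒≥ j≮c))
... | no i≮c  | yes j<c = contradiction (sym eq) (liftIndex-separates j<c (≮⇒≥ i≮c))

liftIndex-fuse : ∀ d c k b j → c ≤ k → liftIndex d (b + c) (liftIndex k b j) ≡ liftIndex (k + d) b j
liftIndex-fuse d c k b j c≤k with j <? b
... | yes j<b rewrite liftIndex-< {k} j<b | liftIndex-< {k + d} j<b = liftIndex-< (<-≤-trans j<b (m≤m+n b c))
... | no j≮b  rewrite liftIndex-≥ {k} (≮⇒≥ j≮b) | liftIndex-≥ {k + d} (≮⇒≥ j≮b) =
  trans (liftIndex-≥ (+-mono-≤ (≮⇒≥ j≮b) c≤k)) (+-assoc j k d)

liftIndex-comm : ∀ d c k b j →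
                 liftIndex d (b + k + c) (liftIndex k b j) ≡ liftIndex k b (liftIndex d (b + c) j)
liftIndex-comm d c k b j with j <? b | j <? b + c
... | yes j<b | _ rewrite liftIndex-< {d} (<-≤-trans j<b (m≤m+n b c)) | liftIndex-< {k} j<b =
  liftIndex-< (<-≤-trans j<b (≤-trans (m≤m+n b k) (m≤m+n (b + k) c)))
... | no j≮b | yes j<b+c rewrite liftIndex-< {d} j<b+c | liftIndex-≥ {k} (≮⇒≥ j≮b) =
  liftIndex-< (subst (j + k <_) (xy∙z≈xz∙y b c k) (+-monoˡ-< k j<b+c))
... | no j≮b | no j≮b+c
  rewrite liftIndex-≥ {d} (≮⇒≥ j≮b+c) | liftIndex-≥ {k} (≮⇒≥ j≮b)
        | liftIndex-≥ {k} (≤-trans (≮⇒≥ j≮b) (m≤m+n j d)) =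
  trans (liftIndex-≥ (subst (_≤ j + k) (xy∙z≈xz∙y b c k) (+-monoˡ-≤ k (≮⇒≥ j≮b+c)))) (xy∙z≈xz∙y j k d)

lift-lift-var : ∀ d c k b j → lift d c (lift k b (var j)) ≡ var (liftIndex d c (liftIndex k b j))
lift-lift-var d c k b j = trans (cong (lift d c) (lift-var k b j)) (lift-var d c (liftIndex k b j))

lift-lift-fuse : ∀ d c k b W → c ≤ k → lift d (b + c) (lift k b W) ≡ lift (k + d) b W
lift-lift-fuse d c k b (sort h)   c≤k = refl
lift-lift-fuse d c k b (var j)    c≤k = begin
  lift d (b + c) (lift k b (var j))           ≡⟨ lift-lift-var d (b + c) k b j ⟩
  var (liftIndex d (b + c) (liftIndex k b j)) ≡⟨ cong var (liftIndex-fuse d c k b j c≤k) ⟩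
  var (liftIndex (k + d) b j)                 ≡⟨ sym (lift-var (k + d) b j) ⟩
  lift (k + d) b (var j)                      ∎
  where open ≡-Reasoning
lift-lift-fuse d c k b (lam A T)  c≤k = cong₂ lam (lift-lift-fuse d c k b A c≤k) (lift-lift-fuse d c k (suc b) T c≤k)
lift-lift-fuse d c k b (abbr A T) c≤k = cong₂ abbr (lift-lift-fuse d c k b A c≤k) (lift-lift-fuse d c k (suc b) T c≤k)
lift-lift-fuse d c k b (appl A T) c≤k = cong₂ appl (lift-lift-fuse d c k b A c≤k) (lift-lift-fuse d c k b T c≤k)
lift-lift-fuse d c k b (cast A T) c≤k = cong₂ cast (lift-lift-fuse d c k b A c≤k) (lift-lift-fuse d c k b T c≤k)

lift-lift-comm : ∀ d c k b W → lift d (b + k + c) (lift k b W) ≡ lift k b (lift d (b + c) W)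
lift-lift-comm d c k b (sort h)   = refl
lift-lift-comm d c k b (var j)    = begin
  lift d (b + k + c) (lift k b (var j))           ≡⟨ lift-lift-var d (b + k + c) k b j ⟩
  var (liftIndex d (b + k + c) (liftIndex k b j)) ≡⟨ cong var (liftIndex-comm d c k b j) ⟩
  var (liftIndex k b (liftIndex d (b + c) j))     ≡⟨ sym (lift-lift-var k b d (b + c) j) ⟩
  lift k b (lift d (b + c) (var j))               ∎
  where open ≡-Reasoning
lift-lift-comm d c k b (lam A T)  = cong₂ lam (lift-lift-comm d c k b A) (lift-lift-comm d c k (suc b) T)
lift-lift-comm d c k b (abbr A T) = cong₂ abbr (lift-lift-comm d c k b A) (lift-lift-comm d c k (suc b) T)
lift-lift-comm d c k b (appl A T) = cong₂ appl (lift-lift-comm d c k b A) (lift-lift-comm d c k b T)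
lift-lift-comm d c k b (cast A T) = cong₂ cast (lift-lift-comm d c k b A) (lift-lift-comm d c k b T)

Free-lift : ∀ d c {x T} → Free x T → Free (liftIndex d c x) (lift d c T)
Free-lift d c {x} fvar       = subst (Free _) (sym (lift-var d c x)) fvar
Free-lift d c     (flamA f)  = flamA (Free-lift d c f)
Free-lift d c {x} (flamT f)  = flamT (subst (λ i → Free i _) (liftIndex-suc d c x) (Free-lift d (suc c) f))
Free-lift d c     (fabbrA f) = fabbrA (Free-lift d c f)
Free-lift d c {x} (fabbrT f) = fabbrT (subst (λ i → Free i _) (liftIndex-suc d c x) (Free-lift d (suc c) f))
Free-lift d c     (fapplA f) = fapplA (Free-lift d c f)
Free-lift d c     (fapplT f) = fapplT (Free-lift d c f)
Free-lift d c     (fcastA f) = fcastA (Free-lift d c f)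
Free-lift d c     (fcastT f) = fcastT (Free-lift d c f)

Free-var⁻¹ : ∀ {i j} → Free i (var j) → i ≡ j
Free-var⁻¹ fvar = refl

Free-lift⁻¹ : ∀ d c {x} T → Free (liftIndex d c x) (lift d c T) → Free x T
Free-lift⁻¹ d c     (sort h)   ()
Free-lift⁻¹ d c {x} (var j)    f
  with liftIndex-injective d c (Free-var⁻¹ (subst (Free _) (lift-var d c j) f))
... | refl = fvar
Free-lift⁻¹ d c     (lam A T)  (flamA f)  = flamA (Free-lift⁻¹ d c A f)
Free-lift⁻¹ d c {x} (lam A T)  (flamT f)  =
  flamT (Free-lift⁻¹ d (suc c) T (subst (λ i → Free i _) (sym (liftIndex-suc d c x)) f))
Free-lift⁻¹ d c     (abbr A T) (fabbrA f) = fabbrA (Free-lift⁻¹ d c A f)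
Free-lift⁻¹ d c {x} (abbr A T) (fabbrT f) =
  fabbrT (Free-lift⁻¹ d (suc c) T (subst (λ i → Free i _) (sym (liftIndex-suc d c x)) f))
Free-lift⁻¹ d c     (appl A T) (fapplA f) = fapplA (Free-lift⁻¹ d c A f)
Free-lift⁻¹ d c     (appl A T) (fapplT f) = fapplT (Free-lift⁻¹ d c T f)
Free-lift⁻¹ d c     (cast A T) (fcastA f) = fcastA (Free-lift⁻¹ d c A f)
Free-lift⁻¹ d c     (cast A T) (fcastT f) = fcastT (Free-lift⁻¹ d c T f)

¬Free-lift : ∀ d c {x} T → ¬ Free x T → ¬ Free (liftIndex d c x) (lift d c T)
¬Free-lift d c T ¬f f = ¬f (Free-lift⁻¹ d c T f)

Rep-lift : ∀ d c {x W b T T'} → Rep x W b T T' →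
           Rep (liftIndex d c x) (lift d c W) b (lift d c T) (lift d c T')
Rep-lift d c rsort = rsort
Rep-lift d c {x} {W} {T = var j} rkeep =
  subst (λ V → Rep (liftIndex d c x) (lift d c W) false V V) (sym (lift-var d c j)) rkeep
Rep-lift d c {x} {W} rrepl =
  subst (λ V → Rep (liftIndex d c x) (lift d c W) true V (lift d c W)) (sym (lift-var d c x)) rrepl
Rep-lift d c {x} {W} (rlam r s) =
  rlam (Rep-lift d c r)
       (subst₂ (λ i U → Rep i U _ _ _) (liftIndex-suc d c x) (lift-lift-comm d c 1 0 W) (Rep-lift d (suc c) s))
Rep-lift d c {x} {W} (rabbr r s) =
  rabbr (Rep-lift d c r)
        (subst₂ (λ i U → Rep i U _ _ _) (liftIndex-suc d c x) (lift-lift-comm d c 1 0 W) (Rep-lift d (suc c) s))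
Rep-lift d c (rappl r s) = rappl (Rep-lift d c r) (Rep-lift d c s)
Rep-lift d c (rcast r s) = rcast (Rep-lift d c r) (Rep-lift d c s)

StrictSubst-lift : ∀ d c {x T W T'} → StrictSubst x T W T' →
                   StrictSubst (liftIndex d c x) (lift d c T) (lift d c W) (lift d c T')
StrictSubst-lift d c {W = W} (¬f , f , r) = ¬Free-lift d c W ¬f , Free-lift d c f , Rep-lift d c r

→0-lift : ∀ d c {T₁ T₂} → T₁ →0 T₂ → lift d c T₁ →0 lift d c T₂
→0-lift d c refl0        = refl0
→0-lift d c (clam p q)   = clam (→0-lift d c p) (→0-lift d (suc c) q)
→0-lift d c (cabbr p q)  = cabbr (→0-lift d c p) (→0-lift d (suc c) q)
→0-lift d c (cappl p q)  = cappl (→0-lift d c p) (→0-lift d c q)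
→0-lift d c (ccast p q)  = ccast (→0-lift d c p) (→0-lift d c q)
→0-lift d c (β0 p q)     = β0 (→0-lift d c p) (→0-lift d (suc c) q)
→0-lift d c (δ0 {V₂ = V₂} p q s) =
  δ0 (→0-lift d c p) (→0-lift d (suc c) q)
     (subst (λ W → StrictSubst 0 _ W _) (lift-lift-comm d c 1 0 V₂) (StrictSubst-lift d (suc c) s))
→0-lift d c (ζ0 {T₁ = T₁} {T₂} p ¬f) =
  ζ0 (subst (_ →0_) (lift-lift-comm d c 1 0 T₂) (→0-lift d (suc c) p)) (¬Free-lift d (suc c) T₁ ¬f)
→0-lift d c (τ0 p)       = τ0 (→0-lift d c p)
→0-lift d c (υ0 {V₃ = V₃} p q r) =
  subst (λ V → _ →0 abbr _ (appl V _)) (sym (lift-lift-comm d c 1 0 V₃))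
        (υ0 (→0-lift d c p) (→0-lift d c q) (→0-lift d (suc c) r))

_++_ : Env → Env → Env
sortE _   ++ E = E
lamE W D  ++ E = lamE W (D ++ E)
abbrE V D ++ E = abbrE V (D ++ E)
applE V D ++ E = applE V (D ++ E)
castE W D ++ E = castE W (D ++ E)

++-∙ : ∀ D E β → (D ++ E) ∙ β ≡ D ++ (E ∙ β)
++-∙ (sortE _)   E β = refl
++-∙ (lamE W D)  E β = cong (lamE W) (++-∙ D E β)
++-∙ (abbrE V D) E β = cong (abbrE V) (++-∙ D E β)
++-∙ (applE V D) E β = cong (applE V) (++-∙ D E β)
++-∙ (castE W D) E β = cong (castE W) (++-∙ D E β)

++-plug : ∀ D C β C₂ → D ++ plug C β C₂ ≡ plug (D ++ C) β C₂
++-plug (sortE _)   C β C₂ = refl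
++-plug (lamE W D)  C β C₂ = cong (lamE W) (++-plug D C β C₂)
++-plug (abbrE V D) C β C₂ = cong (abbrE V) (++-plug D C β C₂)
++-plug (applE V D) C β C₂ = cong (applE V) (++-plug D C β C₂)
++-plug (castE W D) C β C₂ = cong (castE W) (++-plug D C β C₂)

++-terminal : ∀ D → D ++ sortE (terminal D) ≡ D
++-terminal (sortE _)   = refl
++-terminal (lamE W D)  = cong (lamE W) (++-terminal D)
++-terminal (abbrE V D) = cong (abbrE V) (++-terminal D)
++-terminal (applE V D) = cong (applE V) (++-terminal D)
++-terminal (castE W D) = cong (castE W) (++-terminal D)

nb-++ : ∀ D E → nb (D ++ E) ≡ nb D + nb E
nb-++ (sortE _)   E = refl
nb-++ (lamE W D)  E = cong suc (nb-++ D E)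
nb-++ (abbrE V D) E = cong suc (nb-++ D E)
nb-++ (applE V D) E = nb-++ D E
nb-++ (castE W D) E = nb-++ D E

liftItem : ℕ → ℕ → Item → Item
liftItem d c (iλ W) = iλ (lift d c W)
liftItem d c (iδ V) = iδ (lift d c V)

-- Lifted d c c' E E' : E' is E with every entry lifted by d, the cutoff
-- starting at c for the outermost entry and ending at c' below the innermost.
data Lifted (d : ℕ) : ℕ → ℕ → Env → Env → Set where
  sortE : ∀ {c h k} → Lifted d c c (sortE h) (sortE k)
  lamE  : ∀ {c c' W E E'} → Lifted d (suc c) c' E E' → Lifted d c c' (lamE W E) (lamE (lift d c W) E')
  abbrE : ∀ {c c' V E E'} → Lifted d (suc c) c' E E' → Lifted d c c' (abbrE V E) (abbrE (lift d c V) E')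
  applE : ∀ {c c' V E E'} → Lifted d c c' E E' → Lifted d c c' (applE V E) (applE (lift d c V) E')
  castE : ∀ {c c' W E E'} → Lifted d c c' E E' → Lifted d c c' (castE W E) (castE (lift d c W) E')

-- Inserted D c E E' : E' is E with the entries of D inserted at the point
-- where c binders of E remain below; the entries below are lifted by nb D.
data Inserted (D : Env) : ℕ → Env → Env → Set where
  lamE  : ∀ {c W E E'} → Inserted D c E E' → Inserted D c (lamE W E) (lamE W E')
  abbrE : ∀ {c V E E'} → Inserted D c E E' → Inserted D c (abbrE V E) (abbrE V E')
  applE : ∀ {c V E E'} → Inserted D c E E' → Inserted D c (applE V E) (applE V E')
  castE : ∀ {c W E E'} → Inserted D c E E' → Inserted D c (castE W E) (castE W E')
  here  : ∀ {c E E'} → Lifted (nb D) 0 c E E' → Inserted D c E (D ++ E')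

Lifted-∙ : ∀ {d c c' E E'} β → Lifted d c c' E E' → Lifted d c (suc c') (E ∙ β) (E' ∙ liftItem d c' β)
Lifted-∙ (iλ W) sortE = lamE sortE
Lifted-∙ (iδ V) sortE = abbrE sortE
Lifted-∙ β (lamE l)  = lamE (Lifted-∙ β l)
Lifted-∙ β (abbrE l) = abbrE (Lifted-∙ β l)
Lifted-∙ β (applE l) = applE (Lifted-∙ β l)
Lifted-∙ β (castE l) = castE (Lifted-∙ β l)

Inserted-∙ : ∀ {D c E E'} β → Inserted D c E E' → Inserted D (suc c) (E ∙ β) (E' ∙ liftItem (nb D) c β)
Inserted-∙ β (lamE i)  = lamE (Inserted-∙ β i)
Inserted-∙ β (abbrE i) = abbrE (Inserted-∙ β i)
Inserted-∙ β (applE i) = applE (Inserted-∙ β i)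
Inserted-∙ β (castE i) = castE (Inserted-∙ β i)
Inserted-∙ {D} {c} {E} β (here {E' = E'} l) =
  subst (Inserted D (suc c) (E ∙ β)) (sym (++-∙ D E' (liftItem (nb D) c β))) (here (Lifted-∙ β l))

Inserted-plug : ∀ C β C₂ → Inserted (itemE β C₂) 0 C (plug C β C₂)
Inserted-plug (sortE h)   β C₂ = subst (Inserted (itemE β C₂) 0 (sortE h)) (++-terminal (itemE β C₂)) (here sortE)
Inserted-plug (lamE W C)  β C₂ = lamE (Inserted-plug C β C₂)
Inserted-plug (abbrE V C) β C₂ = abbrE (Inserted-plug C β C₂)
Inserted-plug (applE V C) β C₂ = applE (Inserted-plug C β C₂)
Inserted-plug (castE W C) β C₂ = castE (Inserted-plug C β C₂)

Lifted-cutoff : ∀ {d c c' E E'} → Lifted d c c' E E' → c' ≡ nb E + c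
Lifted-cutoff sortE = refl
Lifted-cutoff {c = c} (lamE {E = E} l)  = trans (Lifted-cutoff l) (+-suc (nb E) c)
Lifted-cutoff {c = c} (abbrE {E = E} l) = trans (Lifted-cutoff l) (+-suc (nb E) c)
Lifted-cutoff (applE l) = Lifted-cutoff l
Lifted-cutoff (castE l) = Lifted-cutoff l

Lifted-nb : ∀ {d c c' E E'} → Lifted d c c' E E' → nb E' ≡ nb E
Lifted-nb sortE     = refl
Lifted-nb (lamE l)  = cong suc (Lifted-nb l)
Lifted-nb (abbrE l) = cong suc (Lifted-nb l)
Lifted-nb (applE l) = Lifted-nb l
Lifted-nb (castE l) = Lifted-nb l

Inserted-cutoff : ∀ {D c E E'} → Inserted D c E E' → c ≤ nb E
Inserted-cutoff (lamE i)  = m≤n⇒m≤1+n (Inserted-cutoff i)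
Inserted-cutoff (abbrE i) = m≤n⇒m≤1+n (Inserted-cutoff i)
Inserted-cutoff (applE i) = Inserted-cutoff i
Inserted-cutoff (castE i) = Inserted-cutoff i
Inserted-cutoff {E = E} (here l) = subst (_≤ nb E) (sym (Lifted-cutoff l)) (≤-reflexive (+-identityʳ (nb E)))

Inserted-nb : ∀ {D c E E'} → Inserted D c E E' → nb E' ≡ nb E + nb D
Inserted-nb (lamE i)  = cong suc (Inserted-nb i)
Inserted-nb (abbrE i) = cong suc (Inserted-nb i)
Inserted-nb (applE i) = Inserted-nb i
Inserted-nb (castE i) = Inserted-nb i
Inserted-nb {D} {E = E} (here {E' = E'} l) = begin
  nb (D ++ E')   ≡⟨ nb-++ D E' ⟩
  nb D + nb E'   ≡⟨ cong (nb D +_) (Lifted-nb l) ⟩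
  nb D + nb E    ≡⟨ +-comm (nb D) (nb E) ⟩
  nb E + nb D    ∎
  where open ≡-Reasoning

data LiftedSplit (d c c' : ℕ) (C₁ : Env) (β : Item) (C₂ : Env) : Env → Set where
  split : ∀ {j C₁' C₂'} → Lifted d c j C₁ C₁' → Lifted d (suc j) c' C₂ C₂' →
          LiftedSplit d c c' C₁ β C₂ (plug C₁' (liftItem d j β) C₂')

Lifted-split : ∀ {d c c'} C₁ β C₂ {E} → Lifted d c c' (plug C₁ β C₂) E → LiftedSplit d c c' C₁ β C₂ E
Lifted-split (sortE h)   (iλ W) C₂ (lamE l)  = split {C₁' = sortE h} sortE l
Lifted-split (sortE h)   (iδ V) C₂ (abbrE l) = split {C₁' = sortE h} sortE l
Lifted-split (lamE W C)  β C₂ (lamE l) with Lifted-split C β C₂ l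
... | split l₁ l₂ = split (lamE l₁) l₂
Lifted-split (abbrE V C) β C₂ (abbrE l) with Lifted-split C β C₂ l
... | split l₁ l₂ = split (abbrE l₁) l₂
Lifted-split (applE V C) β C₂ (applE l) with Lifted-split C β C₂ l
... | split l₁ l₂ = split (applE l₁) l₂
Lifted-split (castE W C) β C₂ (castE l) with Lifted-split C β C₂ l
... | split l₁ l₂ = split (castE l₁) l₂

-- The insertion point lies either below the entry β (inside C₂, so only the
-- index of β changes) or above it (inside C₁, so β itself is lifted).
data InsertedSplit (D : Env) (c : ℕ) (C₁ : Env) (β : Item) (C₂ : Env) : Env → Set where
  below : ∀ {C₂'} → Inserted D c C₂ C₂' → InsertedSplit D c C₁ β C₂ (plug C₁ β C₂')
  above : ∀ {j C₁' C₂'} → Inserted D j C₁ C₁' → Lifted (nb D) (suc j) c C₂ C₂' →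
          InsertedSplit D c C₁ β C₂ (plug C₁' (liftItem (nb D) j β) C₂')

Inserted-split-here : ∀ {D c} C₁ β C₂ {E} → Lifted (nb D) 0 c (plug C₁ β C₂) E →
                      InsertedSplit D c C₁ β C₂ (D ++ E)
Inserted-split-here {D} {c} C₁ β C₂ l with Lifted-split C₁ β C₂ l
... | split {j} {C₁'} {C₂'} l₁ l₂ =
  subst (InsertedSplit D c C₁ β C₂) (sym (++-plug D C₁' (liftItem (nb D) j β) C₂')) (above (here l₁) l₂)

Inserted-split : ∀ {D c} C₁ β C₂ {E} → Inserted D c (plug C₁ β C₂) E → InsertedSplit D c C₁ β C₂ E
Inserted-split C₁@(sortE _)   β@(iλ _) C₂ (here l) = Inserted-split-here C₁ β C₂ l
Inserted-split C₁@(sortE _)   β@(iδ _) C₂ (here l) = Inserted-split-here C₁ β C₂ l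
Inserted-split C₁@(lamE _ _)  β C₂ (here l) = Inserted-split-here C₁ β C₂ l
Inserted-split C₁@(abbrE _ _) β C₂ (here l) = Inserted-split-here C₁ β C₂ l
Inserted-split C₁@(applE _ _) β C₂ (here l) = Inserted-split-here C₁ β C₂ l
Inserted-split C₁@(castE _ _) β C₂ (here l) = Inserted-split-here C₁ β C₂ l
Inserted-split (sortE h)   (iλ W) C₂ (lamE i)  = below i
Inserted-split (sortE h)   (iδ V) C₂ (abbrE i) = below i
Inserted-split (lamE W C)  β C₂ (lamE i) with Inserted-split C β C₂ i
... | below i₂    = below i₂
... | above i₁ l₂ = above (lamE i₁) l₂
Inserted-split (abbrE V C) β C₂ (abbrE i) with Inserted-split C β C₂ i
... | below i₂    = below i₂
... | above i₁ l₂ = above (abbrE i₁) l₂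
Inserted-split (applE V C) β C₂ (applE i) with Inserted-split C β C₂ i
... | below i₂    = below i₂
... | above i₁ l₂ = above (applE i₁) l₂
Inserted-split (castE W C) β C₂ (castE i) with Inserted-split C β C₂ i
... | below i₂    = below i₂
... | above i₁ l₂ = above (castE i₁) l₂

lift-bound-below : ∀ {D c C₂ C₂'} X → Inserted D c C₂ C₂' →
                   liftIndex (nb D) c (nb C₂) ≡ nb C₂' ×
                   lift (nb D) c (lift (suc (nb C₂)) 0 X) ≡ lift (suc (nb C₂')) 0 X
lift-bound-below {D} {c} {C₂} X i rewrite Inserted-nb i =
  liftIndex-≥ (Inserted-cutoff i) , lift-lift-fuse (nb D) c (suc (nb C₂)) 0 X (m≤n⇒m≤1+n (Inserted-cutoff i))

lift-bound-above : ∀ {d j c C₂ C₂'} X → Lifted d (suc j) c C₂ C₂' →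
                   liftIndex d c (nb C₂) ≡ nb C₂' ×
                   lift d c (lift (suc (nb C₂)) 0 X) ≡ lift (suc (nb C₂')) 0 (lift d j X)
lift-bound-above {d} {j} {C₂ = C₂} X l rewrite Lifted-cutoff l | +-suc (nb C₂) j | Lifted-nb l =
  liftIndex-< (s≤s (m≤m+n (nb C₂) j)) , lift-lift-comm d j (suc (nb C₂)) 0 X

StrictSubst-reindex : ∀ {x x' T W W' T'} → x ≡ x' × W ≡ W' → StrictSubst x T W T' → StrictSubst x' T W' T'
StrictSubst-reindex (refl , refl) s = s

⊢-lift-var : ∀ {E g d c n m A B} → liftIndex d c n ≡ m × A ≡ B →
             E ⊢[ g ] var m ∶ B → E ⊢[ g ] lift d c (var n) ∶ A
⊢-lift-var {d = d} {c} {n} (refl , refl) t = subst (λ T → _ ⊢[ _ ] T ∶ _) (sym (lift-var d c n)) t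

⇒-lift : ∀ {D c E E' T₁ T₂} → E ⊢ T₁ ⇒ T₂ → Inserted D c E E' → E' ⊢ lift (nb D) c T₁ ⇒ lift (nb D) c T₂
⇒-lift {D} {c} (red0 r) i = red0 (→0-lift (nb D) c r)
⇒-lift {D} {c} (redδ {C₁} {V} {C₂} r s) i with Inserted-split C₁ (iδ V) C₂ i
... | below {C₂'} i₂ =
  redδ {C₁} {V} {C₂'} (→0-lift (nb D) c r)
       (StrictSubst-reindex (lift-bound-below V i₂) (StrictSubst-lift (nb D) c s))
... | above {j} {C₁'} {C₂'} i₁ l₂ =
  redδ {C₁'} {lift (nb D) j V} {C₂'} (→0-lift (nb D) c r)
       (StrictSubst-reindex (lift-bound-above V l₂) (StrictSubst-lift (nb D) c s))

⇔-lift : ∀ {D c E E' T₁ T₂} → E ⊢ T₁ ⇔ T₂ → Inserted D c E E' → E' ⊢ lift (nb D) c T₁ ⇔ lift (nb D) c T₂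
⇔-lift (cstep r)    i = cstep (⇒-lift r i)
⇔-lift (csym p)     i = csym (⇔-lift p i)
⇔-lift (ctrans p q) i = ctrans (⇔-lift p i) (⇔-lift q i)

weaken : ∀ {D c E E' g T U} → E ⊢[ g ] T ∶ U → Inserted D c E E' →
         E' ⊢[ g ] lift (nb D) c T ∶ lift (nb D) c U
weaken tsort i = tsort
weaken {D} {c} (tdef {C₁ = C₁} {V} {C₂} {W} t) i with Inserted-split C₁ (iδ V) C₂ i
... | below {C₂'} i₂ = ⊢-lift-var {d = nb D} {c} (lift-bound-below W i₂) (tdef {C₁ = C₁} {V} {C₂'} t)
... | above {C₁' = C₁'} {C₂'} i₁ l₂ =
  ⊢-lift-var {d = nb D} {c} (lift-bound-above W l₂) (tdef {C₁ = C₁'} {_} {C₂'} (weaken t i₁))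
weaken {D} {c} (tdecl {C₁ = C₁} {W} {C₂} t) i with Inserted-split C₁ (iλ W) C₂ i
... | below {C₂'} i₂ = ⊢-lift-var {d = nb D} {c} (lift-bound-below W i₂) (tdecl {C₁ = C₁} {W} {C₂'} t)
... | above {C₁' = C₁'} {C₂'} i₁ l₂ =
  ⊢-lift-var {d = nb D} {c} (lift-bound-above W l₂) (tdecl {C₁ = C₁'} {_} {C₂'} (weaken t i₁))
weaken (tabbr {V = V} tV tT) i = tabbr (weaken tV i) (weaken tT (Inserted-∙ (iδ V) i))
weaken (tabst {W = W} tW tT) i = tabst (weaken tW i) (weaken tT (Inserted-∙ (iλ W) i))
weaken (tappl tV tT)         i = tappl (weaken tV i) (weaken tT i)
weaken (tcast tT tW)         i = tcast (weaken tT i) (weaken tW i)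
weaken (tconv tU tT conv)    i = tconv (weaken tU i) (weaken tT i) (⇔-lift conv i)

weaken-plug : ∀ {C₁ g T U} β C₂ → C₁ ⊢[ g ] T ∶ U →
              plug C₁ β C₂ ⊢[ g ] lift (suc (nb C₂)) 0 T ∶ lift (suc (nb C₂)) 0 U
weaken-plug {C₁} (iλ W) C₂ t = weaken t (Inserted-plug C₁ (iλ W) C₂)
weaken-plug {C₁} (iδ V) C₂ t = weaken t (Inserted-plug C₁ (iδ V) C₂)

lam-inv : ∀ {E g W U K} → E ⊢[ g ] lam W U ∶ K →
          ∃ λ V → ∃ λ U' → E ⊢[ g ] W ∶ V × (E ∙ iλ W) ⊢[ g ] U ∶ U'
lam-inv (tabst tW tU) = _ , _ , tW , tU
lam-inv (tconv _ t _) = lam-inv t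

validity : ∀ {E g T V} → E ⊢[ g ] T ∶ V → ∃ λ U → E ⊢[ g ] V ∶ U
validity tsort = _ , tsort
validity (tdef {C₂ = C₂} t)  = _ , weaken-plug (iδ _) C₂ (proj₂ (validity t))
validity (tdecl {C₂ = C₂} t) = _ , weaken-plug (iλ _) C₂ t
validity (tabbr tV tT) = _ , tabbr tV (proj₂ (validity tT))
validity (tabst tW tT) = _ , tabst tW (proj₂ (validity tT))
validity (tappl tV tT) with lam-inv (proj₂ (validity tT))
... | _ , _ , tW , tU = _ , tappl tV (tabst tW tU)
validity (tcast tT tW) = _ , tcast tW (proj₂ (validity tW))
validity (tconv tU _ _) = _ , tU

mainTheorem14 : (g : ℕ → ℕ) → (∀ h → h < g h) →
                ∀ (C : Env) (T V : Term) → C ⊢[ g ] T ∶ V →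
                ∃ λ U → C ⊢[ g ] cast V T ∶ U
mainTheorem14 g _ C T V t = _ , tcast t (proj₂ (validity t))
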